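{- Let $G=(V,E)$ be a graph, let $L$ be an ordered list of pairs of vertices of $V$, and let $v\in V$. Let $L_{ -v}$ denote the list $L$ run with $v$ marked unavailable from the beginning. For any time $t$, the symmetric difference $$\textsc{R}^t(L)\oplus \textsc{R}^t(L_{ -v})=(\textsc{R}^t(L)\setminus \textsc{R}^t(L_{ -v}))\cup(\textsc{R}^t(L_{ -v})\setminus\textsc{R}^t(L))$$ is an alternating path $u_0,\ldots,u_k$ ($k\ge 0$) such that: (1) $u_0=v$; (2) for all even $i<k$, $(u_i,u_{i+1})\in \textsc{R}^t(L)$, and for all odd $i<k$, $(u_i,u_{i+1})\in\textsc{R}^t(L_{ -v})$; (3) the query times of the edges along the path strictly increase: for all $i<k-1$, the query time of $\{u_i,u_{i+1}\}$ is earlier than that of $\{u_{i+1},u_{i+2}\}$; (4) the sets of available vertices at time $t$ differ only at $u_k$: if $k$ is odd then $\textsc{A}^t(L_{ -v})=\textsc{A}^t(L)\cup\{u_k\}$, and if $k$ is even then $\textsc{A}^t(L)=\textsc{A}^t(L_{ -v})\cup\{u_k\}$.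
   Context: Greedy (query-commit) matching with list $L$: go through the pairs $(a,b)\in L$ in order; if $\{a,b\}\in E$ and both $a,b$ are available (unmatched and not marked unavailable), match them and mark both unavailable. $\textsc{R}(L)$ is the resulting matching. Viewing this as a timed process, "time $t$" for a position of $L$ refers to the moment just before that pair is queried; $\textsc{R}^t(L)$ is the partial matching built before time $t$ and $\textsc{A}^t(L)$ is the set of available vertices at time $t$. The query time of an edge $\{a,b\}$ is the first time either $(a,b)$ or $(b,a)$ is queried. $L_{ -v}$ is $L$ with the vertex $v$ marked unavailable from the start (so times in $L$ and $L_{ -v}$ are synchronized). -}

module Defs where

open import Data.Nat using (ℕ; zero; suc; _%_)
open import Data.Fin using (Fin; _≟_)
open import Data.Bool using (Bool; true; false; if_then_else_; _∧_; _∨_)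
open import Data.List using (List; []; _∷_; _++_; [_]; foldl; take)
open import Data.List.Membership.Propositional using (_∈_)
open import Data.Product using (_×_; _,_; proj₁; proj₂)
open import Data.Sum using (_⊎_)
open import Relation.Nullary.Decidable using (⌊_⌋)
open import Relation.Binary.PropositionalEquality using (_≡_)

record Graph (n : ℕ) : Set where
  field
    adj        : Fin n → Fin n → Bool
    adj-sym    : ∀ a b → adj a b ≡ adj b a
    adj-irrefl : ∀ a → adj a a ≡ false
open Graph public

Avail : ℕ → Set
Avail n = Fin n → Bool

Matching : ℕ → Set
Matching n = List (Fin n × Fin n)

remove : ∀ {n} → Avail n → Fin n → Avail n
remove A x w = if ⌊ w ≟ x ⌋ then false else A w

allAvail : ∀ {n} → Avail n
allAvail _ = true

step : ∀ {n} → Graph n → Avail n × Matching n → Fin n × Fin n → Avail n × Matching n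
step G (A , M) (a , b) =
  if adj G a b ∧ A a ∧ A b
  then (remove (remove A a) b , M ++ [ (a , b) ])
  else (A , M)

-- state at time t (just before the pair at position t is queried),
-- starting from the availability A0
stateAt : ∀ {n} → Graph n → Avail n → List (Fin n × Fin n) → ℕ → Avail n × Matching n
stateAt G A0 L t = foldl (step G) (A0 , []) (take t L)

R^ : ∀ {n} → Graph n → List (Fin n × Fin n) → ℕ → Matching n
R^ G L t = proj₂ (stateAt G allAvail L t)

A^ : ∀ {n} → Graph n → List (Fin n × Fin n) → ℕ → Avail n
A^ G L t = proj₁ (stateAt G allAvail L t)

R^₋ : ∀ {n} → Graph n → List (Fin n × Fin n) → Fin n → ℕ → Matching n
R^₋ G L v t = proj₂ (stateAt G (remove allAvail v) L t)

A^₋ : ∀ {n} → Graph n → List (Fin n × Fin n) → Fin n → ℕ → Avail n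
A^₋ G L v t = proj₁ (stateAt G (remove allAvail v) L t)

InM : ∀ {n} → Matching n → Fin n → Fin n → Set
InM M a b = ((a , b) ∈ M) ⊎ ((b , a) ∈ M)

SymDiff : ∀ {n} → Matching n → Matching n → Fin n → Fin n → Set
SymDiff M M' a b = (InM M a b × (InM M' a b → Data.Empty.⊥)) ⊎ (InM M' a b × (InM M a b → Data.Empty.⊥))
  where import Data.Empty

SameEdge : ∀ {n} → Fin n → Fin n → Fin n → Fin n → Set
SameEdge a b x y = (a ≡ x × b ≡ y) ⊎ (a ≡ y × b ≡ x)

-- query time of {a,b}: first position of (a,b) or (b,a) in L
-- (equals length L if never queried)
queryTime : ∀ {n} → List (Fin n × Fin n) → Fin n → Fin n → ℕ
queryTime [] a b = 0
queryTime ((x , y) ∷ L) a b =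
  if (⌊ x ≟ a ⌋ ∧ ⌊ y ≟ b ⌋) ∨ (⌊ x ≟ b ⌋ ∧ ⌊ y ≟ a ⌋) then 0 else suc (queryTime L a b)

Even Odd : ℕ → Set
Even i = i % 2 ≡ 0
Odd i = i % 2 ≡ 1

_⇔_ : Set → Set → Set
P ⇔ Q = (P → Q) × (Q → P)
infix 3 _⇔_

{-# OPTIONS --safe #-}
module Submission where

-- Run L and L₋ᵥ side by side.  Their availabilities always agree except at the end u of
-- the path, which is free in one run (the front) and unavailable in the other (the back);
-- at time 0, u = v and the front is the run of L.  A query either acts identically on both
-- runs, or it is an edge {u, w} that only the front can commit to.  Then {u, w} joins the
-- symmetric difference, and w, now unavailable in the old front but still free in the old
-- back, is the new path end with the roles of the runs exchanged.  This edge is queried for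
-- the first time now, hence after all earlier path edges: at an earlier query both of its
-- endpoints would have been free, so it would have been matched then.

open import Defs
open import Data.Nat using (ℕ; zero; suc; _≤_; _<_; z≤n; s≤s; s≤s⁻¹; _≤?_)
open import Data.Nat.Properties using (m≤n⇒m<n∨m≡n; ≤-refl; ≤-reflexive; <⇒≤; m<n⇒m<1+n; n≮n)
open import Data.Fin using (Fin; _≟_)
open import Data.Bool using (Bool; true; false; if_then_else_; _∧_)
open import Data.Bool.Properties using (∧-conicalˡ; ∧-conicalʳ)
open import Data.List using (List; []; _∷_; _++_; [_]; _∷ʳ_; foldl; take; length)
open import Data.List.Properties using (foldl-∷ʳ; ++-assoc; ++-identityʳ)
open import Data.List.Membership.Propositional using (_∈_)
open import Data.List.Membership.Propositional.Properties using (∈-++⁺ˡ; ∈-++⁺ʳ; ∈-++⁻)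
import Data.List.Relation.Unary.Any as Any
open import Data.Product using (Σ; ∃; _×_; _,_; proj₁; proj₂; swap; map; map₂)
import Data.Sum as Sum
open import Data.Sum using (_⊎_; inj₁; inj₂; [_,_]′)
open import Data.Empty using (⊥-elim)
open import Function using (_∘_; id)
open import Relation.Nullary using (¬_; Dec; does; yes; no)
open import Relation.Nullary.Decidable using (⌊_⌋; dec-true; dec-false; isYes≗does; _×-dec_; _⊎-dec_)
open import Relation.Binary.PropositionalEquality
  using (_≡_; _≢_; refl; sym; trans; cong; cong₂; subst; subst₂; ≢-sym)

infix 4 _[_]=_
data _[_]=_ {A : Set} : List A → ℕ → A → Set where
  here  : ∀ {x xs} → (x ∷ xs) [ 0 ]= x
  there : ∀ {y x xs t} → xs [ t ]= x → (y ∷ xs) [ suc t ]= x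

[]=-exists : ∀ {A : Set} (xs : List A) {t} → t < length xs → ∃ λ x → xs [ t ]= x
[]=-exists (x ∷ xs) {zero}  _         = x , here
[]=-exists (x ∷ xs) {suc t} (s≤s t<n) = map₂ there ([]=-exists xs t<n)

take-suc-[]= : ∀ {A : Set} {xs : List A} {t x} → xs [ t ]= x → take (suc t) xs ≡ take t xs ∷ʳ x
take-suc-[]= here = refl
take-suc-[]= {xs = y ∷ _} (there p) = cong (y ∷_) (take-suc-[]= p)

⇔-trans : ∀ {P Q R : Set} → P ⇔ Q → Q ⇔ R → P ⇔ R
⇔-trans (f , g) (h , k) = (λ p → h (f p)) , (λ r → g (k r))

even-or-odd : ∀ k → Even k ⊎ Odd k
even-or-odd zero          = inj₁ refl
even-or-odd (suc zero)    = inj₂ refl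
even-or-odd (suc (suc k)) = even-or-odd k

≤-suc-view : ∀ {i k} → i ≤ suc k → i ≤ k ⊎ i ≡ suc k
≤-suc-view i≤1+k = Sum.map₁ s≤s⁻¹ (m≤n⇒m<n∨m≡n i≤1+k)

orient : ∀ {A : Set} → ℕ → A → A → A × A
orient zero    x y = x , y
orient (suc k) x y = swap (orient k x y)

orient-map : ∀ {A B : Set} (f : A → B) k {x y} → orient k (f x) (f y) ≡ map f f (orient k x y)
orient-map f zero    = refl
orient-map f (suc k) = cong swap (orient-map f k)

orient-both : ∀ {A : Set} (P : A → Set) k {x y} → P x → P y →
  P (proj₁ (orient k x y)) × P (proj₂ (orient k x y))
orient-both P zero    px py = px , py
orient-both P (suc k) px py = swap (orient-both P k px py)

orient-even : ∀ {A : Set} k {x y : A} → Even k → orient k x y ≡ (x , y)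
orient-even zero          _  = refl
orient-even (suc (suc k)) ev = orient-even k ev

orient-odd : ∀ {A : Set} k {x y : A} → Odd k → orient k x y ≡ (y , x)
orient-odd (suc zero)    _  = refl
orient-odd (suc (suc k)) od = orient-odd k od

module _ {n : ℕ} where

  sameEdge? : (a b x y : Fin n) → Dec (SameEdge a b x y)
  sameEdge? a b x y = (a ≟ x ×-dec b ≟ y) ⊎-dec (a ≟ y ×-dec b ≟ x)

  SameEdge-sym : ∀ {a b x y : Fin n} → SameEdge a b x y → SameEdge x y a b
  SameEdge-sym (inj₁ (refl , refl)) = inj₁ (refl , refl)
  SameEdge-sym (inj₂ (refl , refl)) = inj₂ (refl , refl)

  SameEdge-trans : ∀ {a b c d x y : Fin n} → SameEdge a b c d → SameEdge c d x y → SameEdge a b x y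
  SameEdge-trans (inj₁ (refl , refl)) e = e
  SameEdge-trans (inj₂ (refl , refl)) (inj₁ (refl , refl)) = inj₂ (refl , refl)
  SameEdge-trans (inj₂ (refl , refl)) (inj₂ (refl , refl)) = inj₁ (refl , refl)

  SameEdge-fst : ∀ {a b x y : Fin n} → SameEdge a b x y → x ≡ a ⊎ x ≡ b
  SameEdge-fst (inj₁ (refl , refl)) = inj₁ refl
  SameEdge-fst (inj₂ (refl , refl)) = inj₂ refl

  SameEdge-snd : ∀ {a b x y : Fin n} → SameEdge a b x y → y ≡ a ⊎ y ≡ b
  SameEdge-snd (inj₁ (refl , refl)) = inj₂ refl
  SameEdge-snd (inj₂ (refl , refl)) = inj₁ refl

  SameEdge-≢ : ∀ {a b x y : Fin n} → SameEdge a b x y → a ≢ b → x ≢ y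
  SameEdge-≢ (inj₁ (refl , refl)) a≢b = a≢b
  SameEdge-≢ (inj₂ (refl , refl)) a≢b = ≢-sym a≢b

  queryTime-∷ : ∀ (c d x y : Fin n) K →
    queryTime ((c , d) ∷ K) x y ≡ (if does (sameEdge? c d x y) then 0 else suc (queryTime K x y))
  queryTime-∷ c d x y K
    rewrite isYes≗does (c ≟ x) | isYes≗does (d ≟ y) | isYes≗does (c ≟ y) | isYes≗does (d ≟ x) = refl

  queryTime-here : ∀ {c d x y : Fin n} K → SameEdge c d x y → queryTime ((c , d) ∷ K) x y ≡ 0
  queryTime-here {c} {d} {x} {y} K e =
    trans (queryTime-∷ c d x y K) (cong (λ q → if q then 0 else _) (dec-true (sameEdge? c d x y) e))

  queryTime-there : ∀ {c d x y : Fin n} K → ¬ SameEdge c d x y →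
    queryTime ((c , d) ∷ K) x y ≡ suc (queryTime K x y)
  queryTime-there {c} {d} {x} {y} K ¬e =
    trans (queryTime-∷ c d x y K) (cong (λ q → if q then 0 else _) (dec-false (sameEdge? c d x y) ¬e))

  queryTime-first : ∀ {L : List (Fin n × Fin n)} {t a b x y} → L [ t ]= (a , b) → SameEdge a b x y →
    (∀ {c d} → (c , d) ∈ take t L → ¬ SameEdge c d x y) → queryTime L x y ≡ t
  queryTime-first {_ ∷ K} here e _ = queryTime-here K e
  queryTime-first {_ ∷ K} (there p) e fresh =
    trans (queryTime-there K (fresh (Any.here refl)))
          (cong suc (queryTime-first p e (λ m → fresh (Any.there m))))

  InM-[] : ∀ {x y : Fin n} → ¬ InM [] x y
  InM-[] (inj₁ ())
  InM-[] (inj₂ ())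

  InM-resp : ∀ {M : Matching n} {a b x y} → SameEdge x y a b → InM M x y → InM M a b
  InM-resp (inj₁ (refl , refl)) m = m
  InM-resp (inj₂ (refl , refl)) m = Sum.swap m

  InM-∷ʳ : ∀ {M : Matching n} {a b x y} → InM (M ++ [ (a , b) ]) x y ⇔ (InM M x y ⊎ SameEdge x y a b)
  InM-∷ʳ {M} = to , from
    where
    to : ∀ {a b x y} → InM (M ++ [ (a , b) ]) x y → InM M x y ⊎ SameEdge x y a b
    to (inj₁ m) with ∈-++⁻ M m
    ... | inj₁ m′              = inj₁ (inj₁ m′)
    ... | inj₂ (Any.here refl) = inj₂ (inj₁ (refl , refl))
    to (inj₂ m) with ∈-++⁻ M m
    ... | inj₁ m′              = inj₁ (inj₂ m′)
    ... | inj₂ (Any.here refl) = inj₂ (inj₂ (refl , refl))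
    from : ∀ {a b x y} → InM M x y ⊎ SameEdge x y a b → InM (M ++ [ (a , b) ]) x y
    from (inj₁ (inj₁ m))             = inj₁ (∈-++⁺ˡ m)
    from (inj₁ (inj₂ m))             = inj₂ (∈-++⁺ˡ m)
    from (inj₂ (inj₁ (refl , refl))) = inj₁ (∈-++⁺ʳ M (Any.here refl))
    from (inj₂ (inj₂ (refl , refl))) = inj₂ (∈-++⁺ʳ M (Any.here refl))

  symDiff-swap : ∀ {M N : Matching n} {x y} → SymDiff M N x y ⇔ SymDiff N M x y
  symDiff-swap = Sum.swap , Sum.swap

  symDiff-∷ʳ : ∀ {M N : Matching n} {a b} {P : Fin n → Fin n → Set} →
    (∀ x y → SymDiff M N x y ⇔ P x y) → ¬ InM M a b →
    ∀ x y → SymDiff M (N ++ [ (a , b) ]) x y ⇔ (P x y ⊎ SameEdge x y a b)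
  symDiff-∷ʳ {M} {N} {a} {b} {P} old ab∉M x y = to , from
    where
    to : SymDiff M (N ++ [ (a , b) ]) x y → P x y ⊎ SameEdge x y a b
    to (inj₁ (m , ∉N′)) = inj₁ (proj₁ (old x y) (inj₁ (m , λ m′ → ∉N′ (proj₂ InM-∷ʳ (inj₁ m′)))))
    to (inj₂ (m′ , ∉M)) = Sum.map₁ (λ m → proj₁ (old x y) (inj₂ (m , ∉M))) (proj₁ (InM-∷ʳ {N}) m′)
    from : P x y ⊎ SameEdge x y a b → SymDiff M (N ++ [ (a , b) ]) x y
    from (inj₂ e) = inj₂ (proj₂ InM-∷ʳ (inj₂ e) , λ m → ab∉M (InM-resp e m))
    from (inj₁ p) with proj₂ (old x y) p
    ... | inj₁ (m , ∉N) = inj₁ (m , λ m′ → [ ∉N , (λ e → ab∉M (InM-resp e m)) ]′ (proj₁ (InM-∷ʳ {N}) m′))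
    ... | inj₂ (m , ∉M) = inj₂ (proj₂ InM-∷ʳ (inj₁ m) , ∉M)

  InM-exclusive-∷ʳ : ∀ {M N : Matching n} {a b x y} → ¬ InM M a b → ¬ InM N a b →
    (InM (M ++ [ (a , b) ]) x y × ¬ InM (N ++ [ (a , b) ]) x y) ⇔ (InM M x y × ¬ InM N x y)
  InM-exclusive-∷ʳ {M} {N} {a} {b} {x} {y} ab∉M ab∉N = to , from
    where
    to : InM (M ++ [ (a , b) ]) x y × ¬ InM (N ++ [ (a , b) ]) x y → InM M x y × ¬ InM N x y
    to (m′ , ∉N′) with proj₁ (InM-∷ʳ {M}) m′
    ... | inj₁ m = m , λ m″ → ∉N′ (proj₂ InM-∷ʳ (inj₁ m″))
    ... | inj₂ e = ⊥-elim (∉N′ (proj₂ InM-∷ʳ (inj₂ e)))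
    from : InM M x y × ¬ InM N x y → InM (M ++ [ (a , b) ]) x y × ¬ InM (N ++ [ (a , b) ]) x y
    from (m , ∉N) = proj₂ InM-∷ʳ (inj₁ m) , λ m′ → [ ∉N , (λ e → ab∉M (InM-resp e m)) ]′ (proj₁ (InM-∷ʳ {N}) m′)

  symDiff-both-∷ʳ : ∀ {M N : Matching n} {a b x y} → ¬ InM M a b → ¬ InM N a b →
    SymDiff (M ++ [ (a , b) ]) (N ++ [ (a , b) ]) x y ⇔ SymDiff M N x y
  symDiff-both-∷ʳ ab∉M ab∉N =
    Sum.map (proj₁ (InM-exclusive-∷ʳ ab∉M ab∉N)) (proj₁ (InM-exclusive-∷ʳ ab∉N ab∉M)) ,
    Sum.map (proj₂ (InM-exclusive-∷ʳ ab∉M ab∉N)) (proj₂ (InM-exclusive-∷ʳ ab∉N ab∉M))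

  PathEdge : ℕ → (ℕ → Fin n) → Fin n → Fin n → Set
  PathEdge k u x y = ∃ λ i → i < k × SameEdge x y (u i) (u (suc i))

  extend : (ℕ → Fin n) → ℕ → Fin n → ℕ → Fin n
  extend u k w i = if does (i ≤? k) then u i else w

  module _ {u : ℕ → Fin n} {k : ℕ} {w : Fin n} where

    extend-≤ : ∀ {i} → i ≤ k → extend u k w i ≡ u i
    extend-≤ {i} i≤k = cong (λ q → if q then u i else w) (dec-true (i ≤? k) i≤k)

    extend-new : extend u k w (suc k) ≡ w
    extend-new = cong (λ q → if q then u (suc k) else w) (dec-false (suc k ≤? k) (n≮n k))

    extend-old-edge : ∀ {i} (P : Fin n → Fin n → Set) → i < k →
      P (u i) (u (suc i)) → P (extend u k w i) (extend u k w (suc i))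
    extend-old-edge P i<k = subst₂ P (sym (extend-≤ (<⇒≤ i<k))) (sym (extend-≤ i<k))

    extend-new-edge : ∀ (P : Fin n → Fin n → Set) → P (u k) w → P (extend u k w k) (extend u k w (suc k))
    extend-new-edge P = subst₂ P (sym (extend-≤ ≤-refl)) (sym extend-new)

    extend-edges : ∀ (P : ℕ → Fin n → Fin n → Set) → (∀ i → i < k → P i (u i) (u (suc i))) → P k (u k) w →
      ∀ i → i < suc k → P i (extend u k w i) (extend u k w (suc i))
    extend-edges P old new i (s≤s i≤k) with m≤n⇒m<n∨m≡n i≤k
    ... | inj₁ i<k  = extend-old-edge (P i) i<k (old i i<k)
    ... | inj₂ refl = extend-new-edge (P k) new

    PathEdge-extend : ∀ {a b x y} → SameEdge a b (u k) w →
      (PathEdge k u x y ⊎ SameEdge x y a b) ⇔ PathEdge (suc k) (extend u k w) x y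
    PathEdge-extend {a} {b} {x} {y} e = to , from
      where
      to : PathEdge k u x y ⊎ SameEdge x y a b → PathEdge (suc k) (extend u k w) x y
      to (inj₁ (i , i<k , e′)) = i , m<n⇒m<1+n i<k , extend-old-edge (SameEdge x y) i<k e′
      to (inj₂ e′)             = k , ≤-refl , extend-new-edge (SameEdge x y) (SameEdge-trans e′ e)
      from : PathEdge (suc k) (extend u k w) x y → PathEdge k u x y ⊎ SameEdge x y a b
      from (i , i<1+k , e′) =
        extend-edges (λ i p q → SameEdge x y p q → PathEdge k u x y ⊎ SameEdge x y a b)
          (λ i i<k e″ → inj₁ (i , i<k , e″)) (λ e″ → inj₂ (SameEdge-trans e″ (SameEdge-sym e))) i i<1+k e′

    extend-injective : (∀ i j → i ≤ k → j ≤ k → u i ≡ u j → i ≡ j) → (∀ i → i ≤ k → u i ≢ w) →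
      ∀ i j → i ≤ suc k → j ≤ suc k → extend u k w i ≡ extend u k w j → i ≡ j
    extend-injective inj fresh i j i≤ j≤ eq with ≤-suc-view i≤ | ≤-suc-view j≤
    ... | inj₁ i≤k  | inj₁ j≤k  = inj i j i≤k j≤k (trans (sym (extend-≤ i≤k)) (trans eq (extend-≤ j≤k)))
    ... | inj₂ refl | inj₂ refl = refl
    ... | inj₁ i≤k  | inj₂ refl = ⊥-elim (fresh i i≤k (trans (sym (extend-≤ i≤k)) (trans eq extend-new)))
    ... | inj₂ refl | inj₁ j≤k  = ⊥-elim (fresh j j≤k (trans (sym (extend-≤ j≤k)) (trans (sym eq) extend-new)))

module _ {n : ℕ} where

  remove-self : ∀ (A : Avail n) x → remove A x x ≡ false
  remove-self A x with x ≟ x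
  ... | yes _   = refl
  ... | no x≢x = ⊥-elim (x≢x refl)

  remove-other : ∀ (A : Avail n) {x z} → z ≢ x → remove A x z ≡ A z
  remove-other A {x} {z} z≢x with z ≟ x
  ... | yes z≡x = ⊥-elim (z≢x z≡x)
  ... | no _    = refl

  remove-keeps-false : ∀ (A : Avail n) {x z} → A z ≡ false → remove A x z ≡ false
  remove-keeps-false A {x} {z} Az with z ≟ x
  ... | yes _ = refl
  ... | no _  = Az

  remove-cong : ∀ (A A′ : Avail n) x {z} → A z ≡ A′ z → remove A x z ≡ remove A′ x z
  remove-cong A A′ x {z} = cong (λ q → if ⌊ z ≟ x ⌋ then false else q)

module _ {n : ℕ} (G : Graph n) where

  State : Set
  State = Avail n × Matching n

  Free Taken : State → Fin n → Set
  Free  s z = proj₁ s z ≡ true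
  Taken s z = proj₁ s z ≡ false

  free≢taken : ∀ s {x y} → Free s x → Taken s y → x ≢ y
  free≢taken _ fx ty refl with trans (sym fx) ty
  ... | ()

  adj⇒≢ : ∀ {a b} → adj G a b ≡ true → a ≢ b
  adj⇒≢ {a} ab refl with trans (sym ab) (adj-irrefl G a)
  ... | ()

  adj-resp : ∀ {a b x y} → SameEdge x y a b → adj G a b ≡ true → adj G x y ≡ true
  adj-resp (inj₁ (refl , refl)) ab = ab
  adj-resp {a} {b} (inj₂ (refl , refl)) ab = trans (adj-sym G b a) ab

  fires : State → Fin n × Fin n → Bool
  fires (A , _) (a , b) = adj G a b ∧ A a ∧ A b

  commit : State → Fin n × Fin n → State
  commit (A , M) (a , b) = remove (remove A a) b , M ++ [ (a , b) ]

  step-fired : ∀ {s e} → fires s e ≡ true → step G s e ≡ commit s e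
  step-fired {s} {e} = cong (λ q → if q then commit s e else s)

  step-idle : ∀ {s e} → fires s e ≡ false → step G s e ≡ s
  step-idle {s} {e} = cong (λ q → if q then commit s e else s)

  fires-adj : ∀ {s a b} → fires s (a , b) ≡ true → adj G a b ≡ true
  fires-adj {s} {a} {b} = ∧-conicalˡ (adj G a b) (proj₁ s a ∧ proj₁ s b)

  fires-free : ∀ {s a b z} → fires s (a , b) ≡ true → z ≡ a ⊎ z ≡ b → Free s z
  fires-free {s} {a} {b} h (inj₁ refl) = ∧-conicalˡ (proj₁ s a) (proj₁ s b) (∧-conicalʳ (adj G a b) _ h)
  fires-free {s} {a} {b} h (inj₂ refl) = ∧-conicalʳ (proj₁ s a) (proj₁ s b) (∧-conicalʳ (adj G a b) _ h)

  idle-blocked : ∀ {s a b} → fires s (a , b) ≡ false → adj G a b ≡ true → Taken s a ⊎ Taken s b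
  idle-blocked {s} {a} {b} idle ab with proj₁ s a | proj₁ s b
  ... | false | _     = inj₁ refl
  ... | true  | false = inj₂ refl
  ... | true  | true  with subst (λ q → q ∧ true ≡ false) ab idle
  ...   | ()

  commit-takes : ∀ {s a b z} → z ≡ a ⊎ z ≡ b → Taken (commit s (a , b)) z
  commit-takes {A , _} {a} (inj₁ refl) = remove-keeps-false (remove A a) (remove-self A a)
  commit-takes {A , _} {a} {b} (inj₂ refl) = remove-self (remove A a) b

  commit-other : ∀ {s a b z} → z ≢ a → z ≢ b → proj₁ (commit s (a , b)) z ≡ proj₁ s z
  commit-other {A , _} {a} z≢a z≢b = trans (remove-other (remove A a) z≢b) (remove-other A z≢a)

  commit-keeps-taken : ∀ {s e z} → Taken s z → Taken (commit s e) z
  commit-keeps-taken {A , _} {a , b} h = remove-keeps-false (remove A a) (remove-keeps-false A h)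

  commit-cong : ∀ {s s′ e z} → proj₁ s z ≡ proj₁ s′ z → proj₁ (commit s e) z ≡ proj₁ (commit s′ e) z
  commit-cong {A , _} {A′ , _} {a , b} h = remove-cong (remove A a) (remove A′ a) b (remove-cong A A′ a h)

  step-keeps-matched : ∀ {s e x y} → InM (proj₂ s) x y → InM (proj₂ (step G s e)) x y
  step-keeps-matched {s} {e} m with fires s e
  ... | true  = proj₂ (InM-∷ʳ {M = proj₂ s}) (inj₁ m)
  ... | false = m

  record Consistent (H : List (Fin n × Fin n)) (s : State) : Set where
    field
      matched-taken   : ∀ {x y} → InM (proj₂ s) x y → Taken s x × Taken s y
      queried-blocked : ∀ {x y} → (x , y) ∈ H → adj G x y ≡ true → Taken s x ⊎ Taken s y

    endpoint-unmatched : ∀ {a b z} → Free s z → z ≡ a ⊎ z ≡ b → ¬ InM (proj₂ s) a b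
    endpoint-unmatched fz (inj₁ refl) m = free≢taken s fz (proj₁ (matched-taken m)) refl
    endpoint-unmatched fz (inj₂ refl) m = free≢taken s fz (proj₂ (matched-taken m)) refl

  open Consistent

  consistent-step : ∀ {H s} e → Consistent H s → Consistent (H ∷ʳ e) (step G s e)
  consistent-step {H} {s} (a , b) c with fires s (a , b) in fired
  ... | true = record
    { matched-taken   = λ m → [ (λ m′ → map keeps keeps (matched-taken c m′)) ,
                                (λ e → let e′ = SameEdge-sym e in takes (SameEdge-fst e′) , takes (SameEdge-snd e′)) ]′
                              (proj₁ InM-∷ʳ m)
    ; queried-blocked = λ q ab → [ (λ q′ → Sum.map keeps keeps (queried-blocked c q′ ab)) ,
                                   (λ { (Any.here refl) → inj₁ (takes (inj₁ refl)) }) ]′ (∈-++⁻ H q)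
    }
    where
    keeps : ∀ {z} → Taken s z → Taken (commit s (a , b)) z
    keeps = commit-keeps-taken {s}
    takes : ∀ {z} → z ≡ a ⊎ z ≡ b → Taken (commit s (a , b)) z
    takes = commit-takes {s}
  ... | false = record
    { matched-taken   = matched-taken c
    ; queried-blocked = λ q ab → [ (λ q′ → queried-blocked c q′ ab) ,
                                   (λ { (Any.here refl) → idle-blocked {s} fired ab }) ]′ (∈-++⁻ H q)
    }

  consistent-foldl : ∀ {H s} xs → Consistent H s → Consistent (H ++ xs) (foldl (step G) s xs)
  consistent-foldl {H} []       c = subst (λ K → Consistent K _) (sym (++-identityʳ H)) c
  consistent-foldl {H} (e ∷ xs) c =
    subst (λ K → Consistent K _) (++-assoc H [ e ] xs) (consistent-foldl xs (consistent-step e c))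

  consistent-stateAt : ∀ A₀ L t → Consistent (take t L) (stateAt G A₀ L t)
  consistent-stateAt A₀ L t =
    consistent-foldl (take t L) (record { matched-taken = ⊥-elim ∘ InM-[] ; queried-blocked = λ () })

  stateAt-suc : ∀ {A₀ L t e} → L [ t ]= e → stateAt G A₀ L (suc t) ≡ step G (stateAt G A₀ L t) e
  stateAt-suc {A₀} {L} {t} {e} p =
    trans (cong (foldl (step G) (A₀ , [])) (take-suc-[]= p)) (foldl-∷ʳ (step G) (A₀ , []) e (take t L))

  record Frontier (k : ℕ) (u : ℕ → Fin n) (front back : State) : Set where
    field
      symDiff    : ∀ x y → SymDiff (proj₂ front) (proj₂ back) x y ⇔ PathEdge k u x y
      agree      : ∀ z → z ≢ u k → proj₁ front z ≡ proj₁ back z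
      end-free   : Free front (u k)
      end-taken  : Taken back (u k)
      past-taken : ∀ i → i < k → Taken front (u i) × Taken back (u i)

    front-free⇒back-free : ∀ {z} → Free front z → z ≢ u k → Free back z
    front-free⇒back-free {z} fz z≢end = trans (sym (agree z z≢end)) fz

    back-free⇒front-free : ∀ {z} → Free back z → Free front z
    back-free⇒front-free {z} fz = trans (agree z (free≢taken back fz end-taken)) fz

    free-iff : ∀ z → Free front z ⇔ (Free back z ⊎ z ≡ u k)
    free-iff z = to , from
      where
      to : Free front z → Free back z ⊎ z ≡ u k
      to fz with z ≟ u k
      ... | yes z≡end = inj₂ z≡end
      ... | no z≢end  = inj₁ (front-free⇒back-free fz z≢end)
      from : Free back z ⊎ z ≡ u k → Free front z
      from (inj₁ fz)   = back-free⇒front-free fz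
      from (inj₂ refl) = end-free

    blocked-only-at-end : ∀ {z} → Free front z → Taken back z → z ≡ u k
    blocked-only-at-end {z} fz tz with z ≟ u k
    ... | yes z≡end = z≡end
    ... | no z≢end  = ⊥-elim (free≢taken back (front-free⇒back-free fz z≢end) tz refl)

    free-off-path : ∀ {z} → Free front z → z ≢ u k → ∀ i → i ≤ k → u i ≢ z
    free-off-path fz z≢end i i≤k with m≤n⇒m<n∨m≡n i≤k
    ... | inj₁ i<k  = ≢-sym (free≢taken front fz (proj₁ (past-taken i i<k)))
    ... | inj₂ refl = ≢-sym z≢end

  open Frontier

  frontier-commit-both : ∀ {k u F B H H′ a b} → Frontier k u F B → Consistent H F → Consistent H′ B →
    fires F (a , b) ≡ true → fires B (a , b) ≡ true → Frontier k u (commit F (a , b)) (commit B (a , b))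
  frontier-commit-both {k} {u} {F} {B} {a = a} {b} fr cF cB fF fB = record
    { symDiff    = λ x y → ⇔-trans (symDiff-both-∷ʳ (unmatched cF fF) (unmatched cB fB)) (symDiff fr x y)
    ; agree      = λ z z≢end → commit-cong {F} {B} {a , b} (agree fr z z≢end)
    ; end-free   = trans (commit-other {F} (end≢ (inj₁ refl)) (end≢ (inj₂ refl))) (end-free fr)
    ; end-taken  = commit-keeps-taken {B} (end-taken fr)
    ; past-taken = λ i i<k → map (commit-keeps-taken {F}) (commit-keeps-taken {B}) (past-taken fr i i<k)
    }
    where
    unmatched : ∀ {H s} → Consistent H s → fires s (a , b) ≡ true → ¬ InM (proj₂ s) a b
    unmatched {s = s} c f = endpoint-unmatched c (fires-free {s} f (inj₁ refl)) (inj₁ refl)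
    end≢ : ∀ {z} → z ≡ a ⊎ z ≡ b → u k ≢ z
    end≢ z∈ab = ≢-sym (free≢taken B (fires-free {B} fB z∈ab) (end-taken fr))

  frontier-extend : ∀ {k u F B H a b w} → Frontier k u F B → Consistent H B →
    fires F (a , b) ≡ true → SameEdge a b (u k) w → w ≢ u k →
    Frontier (suc k) (extend u k w) B (commit F (a , b))
  frontier-extend {k} {u} {F} {B} {a = a} {b} {w} fr cB fF e w≢end = record
    { symDiff    = λ x y → ⇔-trans (symDiff-∷ʳ (λ x y → ⇔-trans symDiff-swap (symDiff fr x y))
                                                (endpoint-unmatched cB free-w (SameEdge-snd e)) x y)
                                   (PathEdge-extend e)
    ; agree      = agree′
    ; end-free   = subst (Free B) (sym new) free-w
    ; end-taken  = subst (Taken (commit F (a , b))) (sym new) (commit-takes {F} (SameEdge-snd e))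
    ; past-taken = past-taken′
    }
    where
    new : extend u k w (suc k) ≡ w
    new = extend-new {u = u} {k} {w}
    free-w : Free B w
    free-w = front-free⇒back-free fr (fires-free {F} fF (SameEdge-snd e)) w≢end
    agree′ : ∀ z → z ≢ extend u k w (suc k) → proj₁ B z ≡ proj₁ (commit F (a , b)) z
    agree′ z z≢new with z ≟ u k
    ... | yes refl = trans (end-taken fr) (sym (commit-takes {F} (SameEdge-fst e)))
    ... | no z≢end = trans (sym (agree fr z z≢end))
                           (sym (commit-other {F} (avoid (SameEdge-fst (SameEdge-sym e)))
                                                  (avoid (SameEdge-snd (SameEdge-sym e)))))
      where
      avoid : ∀ {c} → c ≡ u k ⊎ c ≡ w → z ≢ c
      avoid (inj₁ refl) = z≢end
      avoid (inj₂ refl) = λ z≡w → z≢new (trans z≡w (sym new))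
    past-taken′ : ∀ i → i < suc k → Taken B (extend u k w i) × Taken (commit F (a , b)) (extend u k w i)
    past-taken′ i (s≤s i≤k) with m≤n⇒m<n∨m≡n i≤k
    ... | inj₁ i<k  = subst (λ z → Taken B z × Taken (commit F (a , b)) z) (sym (extend-≤ {u = u} {k} {w} i≤k))
                        (swap (map (commit-keeps-taken {F}) id (past-taken fr i i<k)))
    ... | inj₂ refl = subst (λ z → Taken B z × Taken (commit F (a , b)) z) (sym (extend-≤ {u = u} {k} {w} i≤k))
                        (end-taken fr , commit-takes {F} (SameEdge-fst e))

  back-fires⇒front-fires : ∀ {k u F B a b} → Frontier k u F B → fires B (a , b) ≡ true → fires F (a , b) ≡ true
  back-fires⇒front-fires {F = F} {B} {a} {b} fr f =
    cong₂ _∧_ (fires-adj {B} f) (cong₂ _∧_ (free-in-front (inj₁ refl)) (free-in-front (inj₂ refl)))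
    where
    free-in-front : ∀ {z} → z ≡ a ⊎ z ≡ b → Free F z
    free-in-front z∈ab = back-free⇒front-free fr (fires-free {B} f z∈ab)

  front-only-fires-at-end : ∀ {k u F B a b} → Frontier k u F B →
    fires F (a , b) ≡ true → fires B (a , b) ≡ false → ∃ λ w → SameEdge a b (u k) w
  front-only-fires-at-end {F = F} {B} {a} {b} fr fF fB with idle-blocked {B} fB (fires-adj {F} fF)
  ... | inj₁ Ba = b , inj₁ (blocked-only-at-end fr (fires-free {F} fF (inj₁ refl)) Ba , refl)
  ... | inj₂ Bb = a , inj₂ (refl , blocked-only-at-end fr (fires-free {F} fF (inj₂ refl)) Bb)

  data Outcome (k : ℕ) (u : ℕ → Fin n) (F B : State) : Fin n × Fin n → Set where
    same : ∀ {e} → Frontier k u (step G F e) (step G B e) → Outcome k u F B e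
    grow : ∀ {a b} w → SameEdge a b (u k) w → fires F (a , b) ≡ true → (∀ i → i ≤ k → u i ≢ w) →
           Frontier (suc k) (extend u k w) (step G B (a , b)) (step G F (a , b)) → Outcome k u F B (a , b)

  frontier-step : ∀ {k u F B H H′} → Frontier k u F B → Consistent H F → Consistent H′ B →
    ∀ e → Outcome k u F B e
  frontier-step {k} {u} {F} {B} fr cF cB (a , b) with fires F (a , b) in fF | fires B (a , b) in fB
  ... | false | false = same (subst₂ (Frontier k u) (sym (step-idle {F} fF)) (sym (step-idle {B} fB)) fr)
  ... | true  | true  = same (subst₂ (Frontier k u) (sym (step-fired {F} fF)) (sym (step-fired {B} fB))
                               (frontier-commit-both fr cF cB fF fB))
  ... | false | true  with trans (sym fF) (back-fires⇒front-fires fr fB)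
  ...   | ()
  frontier-step {k} {u} {F} {B} fr cF cB (a , b) | true | false with front-only-fires-at-end fr fF fB
  ...   | w , e = grow w e fF (free-off-path fr (fires-free {F} fF (SameEdge-snd e)) w≢end)
                    (subst₂ (Frontier (suc k) (extend u k w)) (sym (step-idle {B} fB)) (sym (step-fired {F} fF))
                      (frontier-extend fr cB fF e w≢end))
    where
    w≢end : w ≢ u k
    w≢end = ≢-sym (SameEdge-≢ e (adj⇒≢ (fires-adj {F} fF)))

  module _ (L : List (Fin n × Fin n)) where

    queryTime-committed : ∀ {t s a b x y} → L [ t ]= (a , b) → Consistent (take t L) s →
      fires s (a , b) ≡ true → SameEdge a b x y → queryTime L x y ≡ t
    queryTime-committed {t} {s} {a} {b} {x} {y} p cs f e = queryTime-first p e never-queried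
      where
      never-queried : ∀ {c d} → (c , d) ∈ take t L → ¬ SameEdge c d x y
      never-queried {c} {d} q e′ =
        [ (λ tc → free≢taken s (fires-free {s} f (SameEdge-fst (SameEdge-sym cd≈ab))) tc refl) ,
          (λ td → free≢taken s (fires-free {s} f (SameEdge-snd (SameEdge-sym cd≈ab))) td refl) ]′
        (queried-blocked cs q (adj-resp cd≈ab (fires-adj {s} f)))
        where
        cd≈ab : SameEdge c d a b
        cd≈ab = SameEdge-trans e′ (SameEdge-sym e)

    module _ (v : Fin n) where

      record IncreasingPath (t k : ℕ) (u : ℕ → Fin n) : Set where
        field
          injective      : ∀ i j → i ≤ k → j ≤ k → u i ≡ u j → i ≡ j
          starts-at-v    : u 0 ≡ v
          increasing     : ∀ i → suc (suc i) ≤ k →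
                           queryTime L (u i) (u (suc i)) < queryTime L (u (suc i)) (u (suc (suc i)))
          queried-before : ∀ i → i < k → queryTime L (u i) (u (suc i)) < t

      open IncreasingPath

      IncreasingPath-later : ∀ {t k u} → IncreasingPath t k u → IncreasingPath (suc t) k u
      IncreasingPath-later P = record
        { injective      = injective P
        ; starts-at-v    = starts-at-v P
        ; increasing     = increasing P
        ; queried-before = λ i i<k → m<n⇒m<1+n (queried-before P i i<k)
        }

      IncreasingPath-extend : ∀ {t k u w} → IncreasingPath t k u → (∀ i → i ≤ k → u i ≢ w) →
        queryTime L (u k) w ≡ t → IncreasingPath (suc t) (suc k) (extend u k w)
      IncreasingPath-extend {t} {k} {u} {w} P fresh now = record
        { injective      = extend-injective (injective P) fresh
        ; starts-at-v    = trans (extend-≤ {u = u} {k} {w} z≤n) (starts-at-v P)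
        ; increasing     = increasing′
        ; queried-before = extend-edges (λ _ x y → queryTime L x y < suc t)
                             (λ i i<k → m<n⇒m<1+n (queried-before P i i<k)) (≤-reflexive (cong suc now))
        }
        where
        u′ : ℕ → Fin n
        u′ = extend u k w
        increasing′ : ∀ i → suc (suc i) ≤ suc k →
          queryTime L (u′ i) (u′ (suc i)) < queryTime L (u′ (suc i)) (u′ (suc (suc i)))
        increasing′ i (s≤s 1+i≤k) with m≤n⇒m<n∨m≡n 1+i≤k
        ... | inj₁ 2+i≤k
          rewrite extend-≤ {u = u} {k} {w} (<⇒≤ (<⇒≤ 2+i≤k)) | extend-≤ {u = u} {k} {w} (<⇒≤ 2+i≤k)
                | extend-≤ {u = u} {k} {w} 2+i≤k = increasing P i 2+i≤k
        ... | inj₂ refl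
          rewrite extend-≤ {u = u} {k} {w} (<⇒≤ 1+i≤k) | extend-≤ {u = u} {k} {w} 1+i≤k
                | extend-new {u = u} {k} {w} | now = queried-before P i 1+i≤k

      -- s₁ and s₀ are the runs of L and L₋ᵥ.  For a path with k edges, orient k s₁ s₀ is
      -- (front , back), and edge i was committed by the front of the path with i edges.
      record Invariant (t : ℕ) (s₁ s₀ : State) : Set where
        field
          k           : ℕ
          u           : ℕ → Fin n
          path        : IncreasingPath t k u
          frontier    : Frontier k u (proj₁ (orient k s₁ s₀)) (proj₂ (orient k s₁ s₀))
          alternating : ∀ i → i < k → InM (proj₂ (proj₁ (orient i s₁ s₀))) (u i) (u (suc i))

        frontier-even : Even k → Frontier k u s₁ s₀
        frontier-even ev = subst (λ q → Frontier k u (proj₁ q) (proj₂ q)) (orient-even k ev) frontier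

        frontier-odd : Odd k → Frontier k u s₀ s₁
        frontier-odd od = subst (λ q → Frontier k u (proj₁ q) (proj₂ q)) (orient-odd k od) frontier

        symDiff-path : ∀ x y → SymDiff (proj₂ s₁) (proj₂ s₀) x y ⇔ PathEdge k u x y
        symDiff-path x y with even-or-odd k
        ... | inj₁ ev = symDiff (frontier-even ev) x y
        ... | inj₂ od = ⇔-trans symDiff-swap (symDiff (frontier-odd od) x y)

        alternating-by-parity : ∀ i → i < k →
          (Even i → InM (proj₂ s₁) (u i) (u (suc i))) × (Odd i → InM (proj₂ s₀) (u i) (u (suc i)))
        alternating-by-parity i i<k =
          (λ ev → subst (λ q → InM (proj₂ (proj₁ q)) (u i) (u (suc i))) (orient-even i ev) (alternating i i<k)) ,
          (λ od → subst (λ q → InM (proj₂ (proj₁ q)) (u i) (u (suc i))) (orient-odd i od) (alternating i i<k))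

      initial : Invariant 0 (allAvail , []) (remove allAvail v , [])
      initial = record
        { k           = 0
        ; u           = λ _ → v
        ; path        = record
          { injective      = λ { _ _ z≤n z≤n _ → refl }
          ; starts-at-v    = refl
          ; increasing     = λ _ ()
          ; queried-before = λ _ ()
          }
        ; frontier    = record
          { symDiff    = λ x y → [ ⊥-elim ∘ InM-[] ∘ proj₁ , ⊥-elim ∘ InM-[] ∘ proj₁ ]′ , λ ()
          ; agree      = λ z z≢v → sym (remove-other allAvail z≢v)
          ; end-free   = refl
          ; end-taken  = remove-self allAvail v
          ; past-taken = λ _ ()
          }
        ; alternating = λ _ ()
        }

      invariant-step : ∀ {t e s₁ s₀} → L [ t ]= e → Consistent (take t L) s₁ → Consistent (take t L) s₀ →
        Invariant t s₁ s₀ → Invariant (suc t) (step G s₁ e) (step G s₀ e)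
      invariant-step {t} {e} {s₁} {s₀} p c₁ c₀ I =
        from-outcome (frontier-step frontier (proj₁ consistent) (proj₂ consistent) e)
        where
        open Invariant I
        s₁′ s₀′ F B : State
        s₁′ = step G s₁ e
        s₀′ = step G s₀ e
        F = proj₁ (orient k s₁ s₀)
        B = proj₂ (orient k s₁ s₀)
        consistent : Consistent (take t L) F × Consistent (take t L) B
        consistent = orient-both (Consistent (take t L)) k c₁ c₀
        orient-step : ∀ j → orient j s₁′ s₀′ ≡ map (λ s → step G s e) (λ s → step G s e) (orient j s₁ s₀)
        orient-step j = orient-map (λ s → step G s e) j
        alternating′ : ∀ i → i < k → InM (proj₂ (proj₁ (orient i s₁′ s₀′))) (u i) (u (suc i))
        alternating′ i i<k = subst (λ q → InM (proj₂ (proj₁ q)) (u i) (u (suc i))) (sym (orient-step i))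
                               (step-keeps-matched {proj₁ (orient i s₁ s₀)} {e} (alternating i i<k))
        from-outcome : Outcome k u F B e → Invariant (suc t) s₁′ s₀′
        from-outcome (same fr) = record
          { k           = k
          ; u           = u
          ; path        = IncreasingPath-later path
          ; frontier    = subst (λ q → Frontier k u (proj₁ q) (proj₂ q)) (sym (orient-step k)) fr
          ; alternating = alternating′
          }
        from-outcome (grow w edge fired fresh fr) = record
          { k           = suc k
          ; u           = extend u k w
          ; path        = IncreasingPath-extend path fresh (queryTime-committed p (proj₁ consistent) fired edge)
          ; frontier    = subst (λ q → Frontier (suc k) (extend u k w) (proj₂ q) (proj₁ q))
                                (sym (orient-step k)) fr
          ; alternating = extend-edges (λ i x y → InM (proj₂ (proj₁ (orient i s₁′ s₀′))) x y)
                                       alternating′ new-edge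
          }
          where
          new-edge : InM (proj₂ (proj₁ (orient k s₁′ s₀′))) (u k) w
          new-edge = subst (λ q → InM (proj₂ (proj₁ q)) (u k) w) (sym (orient-step k))
                       (subst (λ s → InM (proj₂ s) (u k) w) (sym (step-fired {F} fired))
                         (proj₂ InM-∷ʳ (inj₂ (SameEdge-sym edge))))

      invariant : ∀ t → t ≤ length L →
        Invariant t (stateAt G allAvail L t) (stateAt G (remove allAvail v) L t)
      invariant zero    _   = initial
      invariant (suc t) t<n with []=-exists L t<n
      ... | e , p = subst₂ (Invariant (suc t)) (sym (stateAt-suc p)) (sym (stateAt-suc p))
                      (invariant-step p (consistent-stateAt allAvail L t)
                                        (consistent-stateAt (remove allAvail v) L t)
                                        (invariant t (<⇒≤ t<n)))

lemma4p2 : ∀ {n} (G : Graph n) (L : List (Fin n × Fin n)) (v : Fin n) (t : ℕ) → t ≤ length L →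
    Σ ℕ λ k → Σ (ℕ → Fin n) λ u →
      -- u_0..u_k is a path (distinct vertices)
      (∀ i j → i ≤ k → j ≤ k → u i ≡ u j → i ≡ j) ×
      -- the symmetric difference is exactly the edge set of the path
      (∀ a b → SymDiff (R^ G L t) (R^₋ G L v t) a b ⇔ ∃ λ i → i < k × SameEdge a b (u i) (u (suc i))) ×
      -- (1)
      u 0 ≡ v ×
      -- (2)
      (∀ i → i < k → (Even i → InM (R^ G L t) (u i) (u (suc i)))
                   × (Odd i → InM (R^₋ G L v t) (u i) (u (suc i)))) ×
      -- (3)
      (∀ i → suc (suc i) ≤ k → queryTime L (u i) (u (suc i)) < queryTime L (u (suc i)) (u (suc (suc i)))) ×
      -- (4)
      (Odd k → ∀ w → (A^₋ G L v t w ≡ true) ⇔ (A^ G L t w ≡ true ⊎ w ≡ u k)) ×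
      (Even k → ∀ w → (A^ G L t w ≡ true) ⇔ (A^₋ G L v t w ≡ true ⊎ w ≡ u k))
lemma4p2 G L v t t≤n =
  k , u , injective , symDiff-path , starts-at-v , alternating-by-parity , increasing ,
  (λ od → Frontier.free-iff (frontier-odd od)) , (λ ev → Frontier.free-iff (frontier-even ev))
  where
  open Invariant (invariant G L v t t≤n)
  open IncreasingPath path
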